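{- Fix a non-negative integer $n$ and a positive integer $b$. Let $a_1$ and $a_2$ be any two integers that are relatively prime to $b$. If $r_n(a_1,b)=r_n(a_2,b)$, then \[ b \mid (6n^2+1-a_1a_2)(a_2-a_1). \]
   Context: For real $x$, the sawtooth function is $((x)) = \{x\}-\tfrac12$ if $x\notin\mathbb Z$ and $((x))=0$ if $x\in\mathbb Z$, where $\{x\}=x-\lfloor x\rfloor$. For a non-negative integer $n$, a positive integer $b$ and an integer $a$ relatively prime to $b$, the Dedekind–Rademacher sum is \[ r_n(a,b)=\sum_{k=0}^{b-1}\left(\left(\frac{ka+n}{b}\right)\right)\left(\left(\frac{k}{b}\right)\right). \] -}

module Defs where

open import Data.Nat as ℕ using (ℕ; zero; suc; NonZero)
open import Data.Integer as ℤ using (ℤ; +_)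
open import Data.Rational as ℚ using (ℚ; 0ℚ; ½; floor; ↧ₙ_)
open import Relation.Nullary.Decidable using (does)
open import Data.Bool using (if_then_else_)

isIntegerᵇ : ℚ → _
isIntegerᵇ x = does (↧ₙ x ℕ.≟ 1)

saw : ℚ → ℚ
saw x = if isIntegerᵇ x then 0ℚ else ((x ℚ.- (floor x ℚ./ 1)) ℚ.- ½)

sumℚ : ℕ → (ℕ → ℚ) → ℚ
sumℚ zero f = 0ℚ
sumℚ (suc m) f = sumℚ m f ℚ.+ f m

r : (n : ℕ) (a : ℤ) (b : ℕ) → .{{NonZero b}} → ℚ
r n a b = sumℚ b (λ k → saw (((+ k) ℤ.* a ℤ.+ + n) ℚ./ b) ℚ.* saw ((+ k) ℚ./ b))

module Submission where

-- Scaled by 2b, the sawtooth ((x/b)) becomes the integer scaledSaw(x mod b), which is 0 or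
-- 2(x mod b) − b; hence 4b²·r_n(a, b) is the integer
--   T(a) = Σ_{k<b} scaledSaw((ka + n) mod b) · scaledSaw(k),
-- and equal sums r_n have equal T.  The heart of the proof is the congruence
--   3a·T(a) ≡ b(1 + a² + 6n²)   (mod b²)   for a coprime to b.
-- Writing ka + n = m_k + q_k·b with m_k the residue, 3a times the k-th summand splits modulo b²
-- into a term depending only on m_k and a term depending only on k.  As k ↦ m_k permutes
-- [0, b), the residue terms can be re-indexed by k; what remains is a quadratic polynomial in k
-- plus a multiple of the indicator of k = 0, summed in closed form.  For a common T the
-- congruences for a₁ and a₂ give b² ∣ b(c₁a₂ − c₂a₁) with cᵢ = 1 + aᵢ² + 6n², and
-- c₁a₂ − c₂a₁ = (6n² + 1 − a₁a₂)(a₂ − a₁).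

open import Defs
open import Data.Nat using (ℕ; NonZero)
open import Data.Integer using (ℤ; +_; _*_; _+_; _-_)
open import Data.Integer.Divisibility using (_∣_)
open import Data.Integer.Coprimality using (Coprime)
open import Relation.Binary.PropositionalEquality using (_≡_)

import Data.Nat as ℕ
import Data.Nat.Properties as ℕ
import Data.Nat.DivMod as ℕ
import Data.Nat.GCD as ℕ
import Data.Nat.Divisibility as ℕ∣
open import Data.Integer using (-_; _/_; _%_; _<_; +<+; suc; ∣_∣)
open import Data.Integer.Properties
open import Data.Integer.DivMod using (a≡a%n+[a/n]*n; n%d<d)
import Data.Integer.Divisibility.Signed as Signed
open Signed using (divides)
import Data.Integer.Coprimality as Coprimality
open import Data.Integer.Tactic.RingSolver using (solve-∀)
open import Data.Rational as ℚ using (ℚ; mkℚ; floor; ↥_; ↧_; ↧ₙ_)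
import Data.Rational.Properties as ℚ
open import Data.Rational.Unnormalised as ℚᵘ using (mkℚᵘ; *≡*; _≃_)
import Data.Rational.Unnormalised.Properties as ℚᵘ
open import Data.Fin as Fin using (Fin; toℕ; fromℕ<)
open import Data.Fin.Properties
  using (any?; punchOut-injective; injective⇒≤; toℕ<n; toℕ-fromℕ<; toℕ-injective)
open import Data.Fin.Permutation using (Permutation; permutation)
import Algebra.Properties.CommutativeMonoid.Sum +-0-commutativeMonoid as FinSum
open import Algebra.Properties.AbelianGroup +-0-abelianGroup using (∙-cancelʳ)
open import Data.Sum using (inj₁; inj₂)
open import Data.Product using (_×_; _,_; ∃; proj₁; proj₂)
open import Function using (_∘_)
open import Function.Definitions using (Injective)
open import Relation.Binary.PropositionalEquality
  using (refl; sym; trans; cong; cong₂; subst; _≢_; module ≡-Reasoning)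
open import Relation.Binary.Definitions using (tri<; tri≈; tri>)
open import Relation.Nullary using (contradiction; yes; no)
open import Relation.Nullary.Decidable using (dec-true; dec-false)


module _ {D : ℕ} .{{_ : ℕ.NonZero D}} where

  <-by-quotient : ∀ {q₁ q₂ : ℤ} {r₁ r₂ : ℕ} → r₁ ℕ.< D → q₁ < q₂ →
                  + r₁ + q₁ * + D < + r₂ + q₂ * + D
  <-by-quotient {q₁} {q₂} {r₁} {r₂} r₁<D q₁<q₂ = begin-strict
    + r₁ + q₁ * + D  <⟨ +-monoˡ-< (q₁ * + D) (+<+ r₁<D) ⟩
    + D + q₁ * + D   ≡⟨ suc-* q₁ (+ D) ⟨
    suc q₁ * + D     ≤⟨ *-monoʳ-≤-nonNeg (+ D) (i<j⇒suc[i]≤j q₁<q₂) ⟩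
    q₂ * + D         ≤⟨ i≤j+i (q₂ * + D) (+ r₂) ⟩
    + r₂ + q₂ * + D  ∎
    where open ≤-Reasoning

  quotient-unique : ∀ {q₁ q₂ : ℤ} {r₁ r₂ : ℕ} → r₁ ℕ.< D → r₂ ℕ.< D →
                    + r₁ + q₁ * + D ≡ + r₂ + q₂ * + D → q₁ ≡ q₂
  quotient-unique {q₁} {q₂} r₁<D r₂<D eq with <-cmp q₁ q₂
  ... | tri< q₁<q₂ _ _ = contradiction eq (<⇒≢ (<-by-quotient r₁<D q₁<q₂))
  ... | tri≈ _ q₁≡q₂ _ = q₁≡q₂
  ... | tri> _ _ q₂<q₁ = contradiction (sym eq) (<⇒≢ (<-by-quotient r₂<D q₂<q₁))

  div-mod-unique : ∀ {x q : ℤ} {r : ℕ} → r ℕ.< D → x ≡ + r + q * + D →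
                   x / + D ≡ q × x % + D ≡ r
  div-mod-unique {x} {q} {r} r<D x≡ = quotient≡ , +-injective remainder≡
    where
      euclid : + (x % + D) + (x / + D) * + D ≡ + r + q * + D
      euclid = trans (sym (a≡a%n+[a/n]*n x (+ D))) x≡
      quotient≡ : x / + D ≡ q
      quotient≡ = quotient-unique (n%d<d x (+ D)) r<D euclid
      remainder≡ : + (x % + D) ≡ + r
      remainder≡ = ∙-cancelʳ (q * + D) (+ (x % + D)) (+ r)
        (trans (cong (λ t → + (x % + D) + t * + D) (sym quotient≡)) euclid)


infix 4 _≈_mod_
record _≈_mod_ (x y m : ℤ) : Set where
  constructor congruent
  field
    divides-difference : m Signed.∣ x - y
open _≈_mod_ public

≡⇒≈mod : ∀ {m x y} → x ≡ y → x ≈ y mod m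
≡⇒≈mod {m} {x} refl = congruent (divides (+ 0) (trans (+-inverseʳ x) (sym (*-zeroˡ m))))

≈mod-sym : ∀ {m x y} → x ≈ y mod m → y ≈ x mod m
≈mod-sym {m} {x} {y} (congruent m∣x-y) =
  congruent (subst (m Signed.∣_) (negate x y) (Signed.∣m⇒∣-m m∣x-y))
  where
    negate : ∀ x y → - (x - y) ≡ y - x
    negate = solve-∀

≈mod-trans : ∀ {m x y z} → x ≈ y mod m → y ≈ z mod m → x ≈ z mod m
≈mod-trans {m} {x} {y} {z} (congruent m∣x-y) (congruent m∣y-z) =
  congruent (subst (m Signed.∣_) (telescope x y z) (Signed.∣m∣n⇒∣m+n m∣x-y m∣y-z))
  where
    telescope : ∀ x y z → (x - y) + (y - z) ≡ x - z
    telescope = solve-∀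

≈mod-+ : ∀ {m x x′ y y′} → x ≈ x′ mod m → y ≈ y′ mod m → x + y ≈ x′ + y′ mod m
≈mod-+ {m} {x} {x′} {y} {y′} (congruent m∣x-x′) (congruent m∣y-y′) =
  congruent (subst (m Signed.∣_) (regroup x x′ y y′) (Signed.∣m∣n⇒∣m+n m∣x-x′ m∣y-y′))
  where
    regroup : ∀ x x′ y y′ → (x - x′) + (y - y′) ≡ (x + y) - (x′ + y′)
    regroup = solve-∀

≈mod-*ʳ : ∀ {m x y} c → x ≈ y mod m → x * c ≈ y * c mod m
≈mod-*ʳ {m} {x} {y} c (congruent m∣x-y) =
  congruent (subst (m Signed.∣_) (distrib x y c) (Signed.∣m⇒∣m*n c m∣x-y))
  where
    distrib : ∀ x y c → (x - y) * c ≡ x * c - y * c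
    distrib = solve-∀

≈mod-cancel : ∀ {x y} b .{{_ : Data.Integer.NonZero b}} → b * x ≈ b * y mod b * b → x ≈ y mod b
≈mod-cancel {x} {y} b (congruent bb∣bx-by) =
  congruent (Signed.*-cancelˡ-∣ b (subst ((b * b) Signed.∣_) (factor b x y) bb∣bx-by))
  where
    factor : ∀ b x y → b * x - b * y ≡ b * (x - y)
    factor = solve-∀

%-≡⇒≈mod : ∀ {D} .{{_ : ℕ.NonZero D}} x y → x % + D ≡ y % + D → x ≈ y mod + D
%-≡⇒≈mod {D} x y x%D≡y%D = congruent (divides (x / + D - y / + D) (begin
  x - y
    ≡⟨ cong₂ _-_ (a≡a%n+[a/n]*n x (+ D)) (a≡a%n+[a/n]*n y (+ D)) ⟩
  (+ (x % + D) + x / + D * + D) - (+ (y % + D) + y / + D * + D)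
    ≡⟨ cong (λ ρ → (+ (x % + D) + x / + D * + D) - (+ ρ + y / + D * + D)) (sym x%D≡y%D) ⟩
  (+ (x % + D) + x / + D * + D) - (+ (x % + D) + y / + D * + D)
    ≡⟨ cancel (+ (x % + D)) (x / + D) (y / + D) (+ D) ⟩
  (x / + D - y / + D) * + D ∎))
  where
    open ≡-Reasoning
    cancel : ∀ r q₁ q₂ d → (r + q₁ * d) - (r + q₂ * d) ≡ (q₁ - q₂) * d
    cancel = solve-∀


sumℤ : ℕ → (ℕ → ℤ) → ℤ
sumℤ ℕ.zero    f = + 0
sumℤ (ℕ.suc L) f = sumℤ L f + f L

sum-cong : ∀ L {f g : ℕ → ℤ} → (∀ k → f k ≡ g k) → sumℤ L f ≡ sumℤ L g
sum-cong ℕ.zero    f≡g = refl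
sum-cong (ℕ.suc L) f≡g = cong₂ _+_ (sum-cong L f≡g) (f≡g L)

sum-+ : ∀ L (f g : ℕ → ℤ) → sumℤ L (λ k → f k + g k) ≡ sumℤ L f + sumℤ L g
sum-+ ℕ.zero    f g = refl
sum-+ (ℕ.suc L) f g = trans (cong (_+ (f L + g L)) (sum-+ L f g))
                            (interchange (sumℤ L f) (sumℤ L g) (f L) (g L))
  where
    interchange : ∀ s t x y → s + t + (x + y) ≡ s + x + (t + y)
    interchange = solve-∀

sum-*ˡ : ∀ L c (f : ℕ → ℤ) → sumℤ L (λ k → c * f k) ≡ c * sumℤ L f
sum-*ˡ ℕ.zero    c f = sym (*-zeroʳ c)
sum-*ˡ (ℕ.suc L) c f = trans (cong (_+ c * f L) (sum-*ˡ L c f))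
                             (sym (*-distribˡ-+ c (sumℤ L f) (f L)))

sum-≈mod : ∀ {m} L {f g : ℕ → ℤ} → (∀ k → k ℕ.< L → f k ≈ g k mod m) →
           sumℤ L f ≈ sumℤ L g mod m
sum-≈mod {m} ℕ.zero          f≈g = ≡⇒≈mod {m} {+ 0} refl
sum-≈mod {m} (ℕ.suc L) {f} {g} f≈g =
  ≈mod-+ {m} {sumℤ L f} {sumℤ L g}
         (sum-≈mod L (λ k k<L → f≈g k (ℕ.m<n⇒m<1+n k<L))) (f≈g L (ℕ.n<1+n L))

sum-quadratic : ∀ c₂ c₁ c₀ L →
  + 6 * sumℤ L (λ k → c₂ * (+ k * + k) + c₁ * + k + c₀)
    ≡ c₂ * ((+ L - + 1) * + L * (+ 2 * + L - + 1)) + + 3 * c₁ * (+ L * (+ L - + 1))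
      + + 6 * c₀ * + L
sum-quadratic c₂ c₁ c₀ ℕ.zero    = empty c₂ c₁ c₀
  where
    empty : ∀ c₂ c₁ c₀ →
      + 6 * + 0 ≡ c₂ * ((+ 0 - + 1) * + 0 * (+ 2 * + 0 - + 1)) + + 3 * c₁ * (+ 0 * (+ 0 - + 1))
                  + + 6 * c₀ * + 0
    empty = solve-∀
sum-quadratic c₂ c₁ c₀ (ℕ.suc L) = begin
  + 6 * (sumℤ L f + f L)      ≡⟨ *-distribˡ-+ (+ 6) (sumℤ L f) (f L) ⟩
  + 6 * sumℤ L f + + 6 * f L  ≡⟨ cong (_+ + 6 * f L) (sum-quadratic c₂ c₁ c₀ L) ⟩
  _                           ≡⟨ extend c₂ c₁ c₀ (+ L) ⟩
  _                           ∎
  where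
    open ≡-Reasoning
    f : ℕ → ℤ
    f k = c₂ * (+ k * + k) + c₁ * + k + c₀
    extend : ∀ c₂ c₁ c₀ X →
      c₂ * ((X - + 1) * X * (+ 2 * X - + 1)) + + 3 * c₁ * (X * (X - + 1)) + + 6 * c₀ * X
        + + 6 * (c₂ * (X * X) + c₁ * X + c₀)
      ≡ c₂ * ((+ 1 + X - + 1) * (+ 1 + X) * (+ 2 * (+ 1 + X) - + 1))
        + + 3 * c₁ * ((+ 1 + X) * (+ 1 + X - + 1)) + + 6 * c₀ * (+ 1 + X)
    extend = solve-∀

δ₀ : ℕ → ℤ
δ₀ ℕ.zero    = + 1
δ₀ (ℕ.suc _) = + 0

m*δ₀m≡0 : ∀ m → + m * δ₀ m ≡ + 0
m*δ₀m≡0 ℕ.zero    = refl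
m*δ₀m≡0 (ℕ.suc m) = *-zeroʳ (+ ℕ.suc m)

sum-δ₀ : ∀ L → sumℤ (ℕ.suc L) δ₀ ≡ + 1
sum-δ₀ ℕ.zero    = refl
sum-δ₀ (ℕ.suc L) = trans (+-identityʳ (sumℤ (ℕ.suc L) δ₀)) (sum-δ₀ L)

-- Shift the first term out of a sum; this matches the recursion of the library's Fin-sums.
sum-first : ∀ L (f : ℕ → ℤ) → sumℤ (ℕ.suc L) f ≡ f 0 + sumℤ L (f ∘ ℕ.suc)
sum-first ℕ.zero    f = +-comm (+ 0) (f 0)
sum-first (ℕ.suc L) f = trans (cong (_+ f (ℕ.suc L)) (sum-first L f))
                              (+-assoc (f 0) (sumℤ L (f ∘ ℕ.suc)) (f (ℕ.suc L)))

sumℤ≡∑ : ∀ L (f : ℕ → ℤ) → sumℤ L f ≡ FinSum.sum (λ (i : Fin L) → f (toℕ i))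
sumℤ≡∑ ℕ.zero    f = refl
sumℤ≡∑ (ℕ.suc L) f = trans (sum-first L f) (cong (λ s → f 0 + s) (sumℤ≡∑ L (f ∘ ℕ.suc)))

-- Pigeonhole: an injective endomap of Fin L is surjective.  Were j missed, punching j out
-- of the values would give an injection Fin (suc L) → Fin L.
injective⇒surjective : ∀ {L} (σ : Fin L → Fin L) → Injective _≡_ _≡_ σ →
                       ∀ j → ∃ λ i → σ i ≡ j
injective⇒surjective {ℕ.zero}  σ σ-inj ()
injective⇒surjective {ℕ.suc L} σ σ-inj j with any? (λ i → σ i Fin.≟ j)
... | yes hit = hit
... | no miss = contradiction (injective⇒≤ squeeze-injective) (ℕ.n≮n L ∘ ℕ.≤-trans (ℕ.n<1+n L))
  where
    misses : ∀ i → j ≢ σ i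
    misses i j≡σi = miss (i , sym j≡σi)
    squeeze : Fin (ℕ.suc L) → Fin L
    squeeze i = Fin.punchOut (misses i)
    squeeze-injective : Injective _≡_ _≡_ squeeze
    squeeze-injective {i} {i′} eq = σ-inj (punchOut-injective (misses i) (misses i′) eq)

sum-reindex : ∀ L (σ : ℕ → ℕ) → (∀ k → k ℕ.< L → σ k ℕ.< L) →
              (∀ {i j} → i ℕ.< L → j ℕ.< L → σ i ≡ σ j → i ≡ j) →
              ∀ h → sumℤ L (h ∘ σ) ≡ sumℤ L h
sum-reindex L σ σ< σ-inj h = begin
  sumℤ L (h ∘ σ)
    ≡⟨ sumℤ≡∑ L (h ∘ σ) ⟩
  FinSum.sum {L} (λ i → h (σ (toℕ i)))
    ≡⟨ FinSum.sum-cong-≗ {L} {λ i → h (σ (toℕ i))} {h ∘ toℕ ∘ σᶠ} σᶠ-agrees ⟩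
  FinSum.sum {L} (h ∘ toℕ ∘ σᶠ)
    ≡⟨ FinSum.sum-permute {L} {L} (h ∘ toℕ) π ⟨
  FinSum.sum {L} (h ∘ toℕ)
    ≡⟨ sumℤ≡∑ L h ⟨
  sumℤ L h ∎
  where
    open ≡-Reasoning
    σᶠ : Fin L → Fin L
    σᶠ i = fromℕ< (σ< (toℕ i) (toℕ<n i))
    σᶠ-agrees : ∀ i → h (σ (toℕ i)) ≡ h (toℕ (σᶠ i))
    σᶠ-agrees i = cong h (sym (toℕ-fromℕ< (σ< (toℕ i) (toℕ<n i))))
    σᶠ-injective : Injective _≡_ _≡_ σᶠ
    σᶠ-injective {i} {j} eq = toℕ-injective (σ-inj (toℕ<n i) (toℕ<n j)
      (trans (sym (toℕ-fromℕ< _)) (trans (cong toℕ eq) (toℕ-fromℕ< _))))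
    preimage : ∀ j → ∃ λ i → σᶠ i ≡ j
    preimage = injective⇒surjective σᶠ σᶠ-injective
    π : Permutation L L
    π = permutation σᶠ (proj₁ ∘ preimage) (proj₂ ∘ preimage)
                    (λ i → σᶠ-injective (proj₂ (preimage (σᶠ i))))


module _ {b : ℕ} .{{_ : ℕ.NonZero b}} {a : ℤ} (a⊥b : Coprime a (+ b)) (c : ℤ) where

  affineResidue : ℕ → ℕ
  affineResidue k = (+ k * a + c) % + b

  -- If i and i + d in [0, b) have equal residues then b ∣ d·a, so b ∣ d and d = 0.
  residue-collision : ∀ i d → i ℕ.+ d ℕ.< b →
                      affineResidue (i ℕ.+ d) ≡ affineResidue i → d ≡ 0
  residue-collision i ℕ.zero      i+d<b eq = refl
  residue-collision i d@(ℕ.suc _) i+d<b eq = contradiction b∣d (ℕ∣.>⇒∤ d<b)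
    where
      d<b : d ℕ.< b
      d<b = ℕ.m+n≤o⇒n≤o i (subst (ℕ._≤ b) (sym (ℕ.+-suc i d)) i+d<b)
      difference : (+ (i ℕ.+ d) * a + c) - (+ i * a + c) ≡ a * + d
      difference = trans (cong (λ t → (t * a + c) - (+ i * a + c)) (pos-+ i d))
                         (expand (+ i) (+ d) a c)
        where
          expand : ∀ i d a c → ((i + d) * a + c) - (i * a + c) ≡ a * d
          expand = solve-∀
      b∣ad : + b ∣ a * + d
      b∣ad = subst (+ b ∣_) difference
        (Signed.∣⇒∣ᵤ (divides-difference (%-≡⇒≈mod (+ (i ℕ.+ d) * a + c) (+ i * a + c) eq)))
      b∣d : b ℕ∣.∣ d
      b∣d = Coprimality.coprime-divisor (+ b) a (+ d) (Coprimality.sym {a} {+ b} a⊥b) b∣ad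

  affineResidue-injective : ∀ {i j} → i ℕ.< b → j ℕ.< b →
                            affineResidue i ≡ affineResidue j → i ≡ j
  affineResidue-injective {i} {j} i<b j<b eq with ℕ.≤-total i j
  ... | inj₁ i≤j with d , refl ← ℕ.m≤n⇒∃[o]m+o≡n i≤j =
    sym (trans (cong (i ℕ.+_) (residue-collision i d j<b (sym eq))) (ℕ.+-identityʳ i))
  ... | inj₂ j≤i with d , refl ← ℕ.m≤n⇒∃[o]m+o≡n j≤i =
    trans (cong (j ℕ.+_) (residue-collision j d i<b eq)) (ℕ.+-identityʳ j)

  sum-over-residues : ∀ h → sumℤ b (h ∘ affineResidue) ≡ sumℤ b h
  sum-over-residues = sum-reindex b affineResidue
    (λ k _ → n%d<d (+ k * a + c) (+ b)) affineResidue-injective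


floor≡↥/↧ : ∀ p → floor p ≡ ↥ p / ↧ p
floor≡↥/↧ (mkℚ _ _ _) = refl

-- The reduced fraction x / b = ↥/↧ arises by cancelling g = gcd(x, b): x = ↥·g, b = ↧·g.
module _ (x : ℤ) (b : ℕ) .{{_ : ℕ.NonZero b}} where

  private
    g : ℕ
    g = ℕ.gcd ∣ x ∣ b

  ↧ₙ*g≡b : ↧ₙ (x ℚ./ b) ℕ.* g ≡ b
  ↧ₙ*g≡b = +-injective (trans (pos-* (↧ₙ (x ℚ./ b)) g) (ℚ.↧-/ x b))

  -- ⌊x/b⌋ is the Euclidean quotient of x by b: ↥ = ρ + q·↧ with ρ < ↧ scales by g to
  -- x = ρ·g + q·b with ρ·g < b.
  floor-/ : floor (x ℚ./ b) ≡ x / + b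
  floor-/ = trans (floor≡↥/↧ p) (sym (proj₁ (div-mod-unique ρ*g<b x≡)))
    where
      p : ℚ
      p = x ℚ./ b
      ρ : ℕ
      ρ = ↥ p % ↧ p
      q : ℤ
      q = ↥ p / ↧ p
      instance
        g≢0 : ℕ.NonZero g
        g≢0 = ℕ.≢-nonZero (ℕ.gcd[m,n]≢0 ∣ x ∣ b (inj₂ (ℕ.≢-nonZero⁻¹ b)))
      ρ*g<b : ρ ℕ.* g ℕ.< b
      ρ*g<b = subst (ρ ℕ.* g ℕ.<_) ↧ₙ*g≡b (ℕ.*-monoˡ-< g (n%d<d (↥ p) (↧ p)))
      x≡ : x ≡ + (ρ ℕ.* g) + q * + b
      x≡ = begin
        x                            ≡⟨ ℚ.↥-/ x b ⟨
        ↥ p * + g                    ≡⟨ cong (_* + g) (a≡a%n+[a/n]*n (↥ p) (↧ p)) ⟩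
        (+ ρ + q * ↧ p) * + g        ≡⟨ distribute (+ ρ) q (↧ p) (+ g) ⟩
        + ρ * + g + q * (↧ p * + g)  ≡⟨ cong₂ (λ s t → s + q * t) (sym (pos-* ρ g)) (ℚ.↧-/ x b) ⟩
        + (ρ ℕ.* g) + q * + b        ∎
        where
          open ≡-Reasoning
          distribute : ∀ r q d g → (r + q * d) * g ≡ r * g + q * (d * g)
          distribute = solve-∀

  -- x/b is an integer exactly when b divides x (both directions go through g = b).
  integral⇒%≡0 : ↧ₙ (x ℚ./ b) ≡ 1 → x % + b ≡ 0
  integral⇒%≡0 ↧ₙ≡1 = proj₂ (div-mod-unique {q = ↥ (x ℚ./ b)} (ℕ.>-nonZero⁻¹ b) x≡)
    where
      g≡b : g ≡ b
      g≡b = trans (sym (ℕ.*-identityˡ g)) (trans (cong (ℕ._* g) (sym ↧ₙ≡1)) ↧ₙ*g≡b)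
      x≡ : x ≡ + 0 + ↥ (x ℚ./ b) * + b
      x≡ = trans (sym (ℚ.↥-/ x b))
                 (trans (cong (λ t → ↥ (x ℚ./ b) * + t) g≡b) (sym (+-identityˡ _)))

  %≡0⇒integral : x % + b ≡ 0 → ↧ₙ (x ℚ./ b) ≡ 1
  %≡0⇒integral x%b≡0 = ℕ.*-cancelʳ-≡ (↧ₙ (x ℚ./ b)) 1 b
    (trans (cong (↧ₙ (x ℚ./ b) ℕ.*_) (sym g≡b)) (trans ↧ₙ*g≡b (sym (ℕ.*-identityˡ b))))
    where
      x≡ : x ≡ x / + b * + b
      x≡ = trans (a≡a%n+[a/n]*n x (+ b))
                 (trans (cong (λ t → + t + x / + b * + b) x%b≡0) (+-identityˡ _))
      b∣x : b ℕ∣.∣ ∣ x ∣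
      b∣x = ℕ∣.divides ∣ x / + b ∣ (trans (cong ∣_∣ x≡) (abs-* (x / + b) (+ b)))
      g≡b : g ≡ b
      g≡b = ℕ∣.∣-antisym (ℕ.gcd[m,n]∣n ∣ x ∣ b) (ℕ.gcd-greatest b∣x ℕ∣.∣-refl)

saw-integral : ∀ p → ↧ₙ p ≡ 1 → saw p ≡ ℚ.0ℚ
saw-integral p ↧ₙ≡1 rewrite dec-true (↧ₙ p ℕ.≟ 1) ↧ₙ≡1 = refl

saw-fractional : ∀ p → ↧ₙ p ≢ 1 → saw p ≡ (p ℚ.- (floor p ℚ./ 1)) ℚ.- ℚ.½
saw-fractional p ↧ₙ≢1 rewrite dec-false (↧ₙ p ℕ.≟ 1) ↧ₙ≢1 = refl

-- Transfer to unnormalised rationals, where arithmetic is by cross-multiplication.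
toℚᵘ-homo-− : ∀ p q → ℚ.toℚᵘ (p ℚ.- q) ≃ ℚ.toℚᵘ p ℚᵘ.- ℚ.toℚᵘ q
toℚᵘ-homo-− p q =
  ℚᵘ.≃-trans (ℚ.toℚᵘ-homo-+ p (ℚ.- q)) (ℚᵘ.+-congʳ (ℚ.toℚᵘ p) (ℚ.toℚᵘ-homo‿- q))

toℚᵘ-/ : ∀ x d-1 → ℚ.toℚᵘ (x ℚ./ ℕ.suc d-1) ≃ x ℚᵘ./ ℕ.suc d-1
toℚᵘ-/ x d-1 = ℚ.toℚᵘ-fromℚᵘ (mkℚᵘ x d-1)

fractional-part : ∀ m q b-1 → let b = ℕ.suc b-1 in
                  ((+ m + q * + b) ℚᵘ./ b ℚᵘ.- q ℚᵘ./ 1) ℚᵘ.- + 1 ℚᵘ./ 2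
                    ≃ (+ 2 * + m - + b) ℚᵘ./ (b ℕ.+ b)
fractional-part m q b-1 = *≡* (cross-multiplied (+ m) q (+ ℕ.suc b-1))
  where
    cross-multiplied : ∀ m q B →
      (((m + q * B) * + 1 + - q * B) * + 2 + - (+ 1) * (B * + 1)) * (B + B)
        ≡ (+ 2 * m - B) * (B * + 1 * + 2)
    cross-multiplied = solve-∀

-- scaledSaw B m = 2b·((m/b)) for a residue 0 ≤ m < b, where B = b: 0 at m = 0, else 2m − b.
scaledSaw : ℤ → ℕ → ℤ
scaledSaw B ℕ.zero      = + 0
scaledSaw B m@(ℕ.suc _) = + 2 * + m - B

saw-/ : ∀ b-1 x → let b = ℕ.suc b-1 in
        ℚ.toℚᵘ (saw (x ℚ./ b)) ≃ scaledSaw (+ b) (x % + b) ℚᵘ./ (b ℕ.+ b)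
saw-/ b-1 x with x % + ℕ.suc b-1 in x%b≡
... | ℕ.zero = ℚᵘ.≃-trans (ℚᵘ.≃-reflexive (cong ℚ.toℚᵘ (saw-integral p (%≡0⇒integral x b x%b≡))))
                         (*≡* refl)
  where
    b : ℕ
    b = ℕ.suc b-1
    p : ℚ
    p = x ℚ./ b
... | m@(ℕ.suc _) = begin
  ℚ.toℚᵘ (saw p)
    ≡⟨ cong ℚ.toℚᵘ (saw-fractional p not-integral) ⟩
  ℚ.toℚᵘ ((p ℚ.- (floor p ℚ./ 1)) ℚ.- ℚ.½)
    ≡⟨ cong (λ t → ℚ.toℚᵘ ((p ℚ.- (t ℚ./ 1)) ℚ.- ℚ.½)) (floor-/ x b) ⟩
  ℚ.toℚᵘ ((p ℚ.- (q ℚ./ 1)) ℚ.- ℚ.½)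
    ≈⟨ toℚᵘ-homo-− (p ℚ.- (q ℚ./ 1)) ℚ.½ ⟩
  ℚ.toℚᵘ (p ℚ.- (q ℚ./ 1)) ℚᵘ.- ℚ.toℚᵘ ℚ.½
    ≈⟨ ℚᵘ.+-cong (toℚᵘ-homo-− p (q ℚ./ 1)) (ℚᵘ.-‿cong (toℚᵘ-/ (+ 1) 1)) ⟩
  (ℚ.toℚᵘ p ℚᵘ.- ℚ.toℚᵘ (q ℚ./ 1)) ℚᵘ.- + 1 ℚᵘ./ 2
    ≈⟨ ℚᵘ.+-congˡ (ℚᵘ.- (+ 1 ℚᵘ./ 2)) (ℚᵘ.+-cong (toℚᵘ-/ x b-1) (ℚᵘ.-‿cong (toℚᵘ-/ q 0))) ⟩
  (x ℚᵘ./ b ℚᵘ.- q ℚᵘ./ 1) ℚᵘ.- + 1 ℚᵘ./ 2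
    ≡⟨ cong (λ y → (y ℚᵘ./ b ℚᵘ.- q ℚᵘ./ 1) ℚᵘ.- + 1 ℚᵘ./ 2) x≡ ⟩
  ((+ m + q * + b) ℚᵘ./ b ℚᵘ.- q ℚᵘ./ 1) ℚᵘ.- + 1 ℚᵘ./ 2
    ≈⟨ fractional-part m q b-1 ⟩
  (+ 2 * + m - + b) ℚᵘ./ (b ℕ.+ b) ∎
  where
    open ℚᵘ.≃-Reasoning
    b : ℕ
    b = ℕ.suc b-1
    p : ℚ
    p = x ℚ./ b
    q : ℤ
    q = x / + b
    not-integral : ↧ₙ p ≢ 1
    not-integral integral with () ← trans (sym x%b≡) (integral⇒%≡0 x b integral)
    x≡ : x ≡ + m + q * + b
    x≡ = trans (a≡a%n+[a/n]*n x (+ b)) (cong (λ ρ → + ρ + q * + b) x%b≡)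

sumℚ-common-denominator : ∀ d-1 L (f : ℕ → ℚ) (F : ℕ → ℤ) →
  (∀ k → k ℕ.< L → ℚ.toℚᵘ (f k) ≃ F k ℚᵘ./ ℕ.suc d-1) →
  ℚ.toℚᵘ (sumℚ L f) ≃ sumℤ L F ℚᵘ./ ℕ.suc d-1
sumℚ-common-denominator d-1 ℕ.zero    f F f≃F = *≡* refl
sumℚ-common-denominator d-1 (ℕ.suc L) f F f≃F = begin
  ℚ.toℚᵘ (sumℚ L f ℚ.+ f L)           ≈⟨ ℚ.toℚᵘ-homo-+ (sumℚ L f) (f L) ⟩
  ℚ.toℚᵘ (sumℚ L f) ℚᵘ.+ ℚ.toℚᵘ (f L)  ≈⟨ ℚᵘ.+-cong sum≃ (f≃F L (ℕ.n<1+n L)) ⟩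
  sumℤ L F ℚᵘ./ d ℚᵘ.+ F L ℚᵘ./ d     ≈⟨ *≡* (add-numerators (sumℤ L F) (F L) (+ d)) ⟩
  (sumℤ L F + F L) ℚᵘ./ d             ∎
  where
    open ℚᵘ.≃-Reasoning
    d : ℕ
    d = ℕ.suc d-1
    sum≃ : ℚ.toℚᵘ (sumℚ L f) ≃ sumℤ L F ℚᵘ./ d
    sum≃ = sumℚ-common-denominator d-1 L f F (λ k k<L → f≃F k (ℕ.m<n⇒m<1+n k<L))
    add-numerators : ∀ s t D → (s * D + t * D) * D ≡ (s + t) * (D * D)
    add-numerators = solve-∀

rNumerator : (n : ℕ) (a : ℤ) (b : ℕ) .{{_ : ℕ.NonZero b}} → ℤ
rNumerator n a b = sumℤ b (λ k → scaledSaw (+ b) ((+ k * a + + n) % + b) * scaledSaw (+ b) k)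

r≃rNumerator : ∀ n a b-1 → let b = ℕ.suc b-1 in
               ℚ.toℚᵘ (r n a b) ≃ rNumerator n a b ℚᵘ./ ((b ℕ.+ b) ℕ.* (b ℕ.+ b))
r≃rNumerator n a b-1 = sumℚ-common-denominator _ b _ _ term
  where
    b : ℕ
    b = ℕ.suc b-1
    saw-k/b : ∀ k → k ℕ.< b → ℚ.toℚᵘ (saw (+ k ℚ./ b)) ≃ scaledSaw (+ b) k ℚᵘ./ (b ℕ.+ b)
    saw-k/b k k<b = subst (λ m → ℚ.toℚᵘ (saw (+ k ℚ./ b)) ≃ scaledSaw (+ b) m ℚᵘ./ (b ℕ.+ b))
                          (ℕ.m<n⇒m%n≡m k<b) (saw-/ b-1 (+ k))
    term : ∀ k → k ℕ.< b →
           ℚ.toℚᵘ (saw ((+ k * a + + n) ℚ./ b) ℚ.* saw (+ k ℚ./ b))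
             ≃ scaledSaw (+ b) ((+ k * a + + n) % + b) * scaledSaw (+ b) k
                 ℚᵘ./ ((b ℕ.+ b) ℕ.* (b ℕ.+ b))
    term k k<b = ℚᵘ.≃-trans (ℚ.toℚᵘ-homo-* (saw ((+ k * a + + n) ℚ./ b)) (saw (+ k ℚ./ b)))
                            (ℚᵘ.*-cong (saw-/ b-1 (+ k * a + + n)) (saw-k/b k k<b))

rNumerator-injective : ∀ n a₁ a₂ b-1 → r n a₁ (ℕ.suc b-1) ≡ r n a₂ (ℕ.suc b-1) →
                       rNumerator n a₁ (ℕ.suc b-1) ≡ rNumerator n a₂ (ℕ.suc b-1)
rNumerator-injective n a₁ a₂ b-1 r≡r
  with ℚᵘ.≃-trans (ℚᵘ.≃-sym (r≃rNumerator n a₁ b-1))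
         (ℚᵘ.≃-trans (ℚᵘ.≃-reflexive (cong ℚ.toℚᵘ r≡r)) (r≃rNumerator n a₂ b-1))
... | *≡* cross-multiplied = *-cancelʳ-≡ _ _ _ cross-multiplied


scaledSaw≡ : ∀ B m → scaledSaw B m ≡ + 2 * + m - B + B * δ₀ m
scaledSaw≡ B ℕ.zero      = at-zero B
  where
    at-zero : ∀ B → + 0 ≡ + 2 * + 0 - B + B * + 1
    at-zero = solve-∀
scaledSaw≡ B m@(ℕ.suc _) = off-zero B (+ m)
  where
    off-zero : ∀ B m → + 2 * m - B ≡ + 2 * m - B + B * + 0
    off-zero = solve-∀

-- With k·a + N = m + q·B, 3a·scaledSaw(m)·scaledSaw(k) splits modulo B² into a term
-- depending on the residue m alone and a term depending on the index k alone.
residueTerm : (a B N : ℤ) → ℕ → ℤ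
residueTerm a B N m =
  + 6 * (+ m * + m) - + 12 * N * + m - + 6 * a * B * + m - + 6 * B * N * δ₀ m

indexTerm : (a B N : ℤ) → ℕ → ℤ
indexTerm a B N k =
  + 6 * ((+ k * a + N) * (+ k * a + N)) - + 6 * a * B * + k + + 6 * a * B * N * δ₀ k

-- The splitting is a polynomial identity once m·δ₀ m = k·δ₀ k = 0 is used.
term-congruence : ∀ a B N k m q → N ≡ + m + q * B - + k * a →
  + 3 * a * (scaledSaw B m * scaledSaw B k) ≈ residueTerm a B N m + indexTerm a B N k mod B * B
term-congruence a B _ k m q refl = congruent (divides W (begin
  + 3 * a * (scaledSaw B m * scaledSaw B k) - (residueTerm a B N m + indexTerm a B N k)
    ≡⟨ cong₂ (λ s t → + 3 * a * (s * t) - (residueTerm a B N m + indexTerm a B N k))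
             (scaledSaw≡ B m) (scaledSaw≡ B k) ⟩
  + 3 * a * ((+ 2 * + m - B + B * δ₀ m) * (+ 2 * + k - B + B * δ₀ k))
    - (residueTerm a B N m + indexTerm a B N k)
    ≡⟨ expand a B (+ m) (+ k) q (δ₀ m) (δ₀ k) ⟩
  W * (B * B) + + 6 * B * (+ m * δ₀ m) + + 6 * (a * a) * B * (+ k * δ₀ k)
    ≡⟨ cong₂ (λ s t → W * (B * B) + + 6 * B * s + + 6 * (a * a) * B * t) (m*δ₀m≡0 m) (m*δ₀m≡0 k) ⟩
  W * (B * B) + + 6 * B * + 0 + + 6 * (a * a) * B * + 0
    ≡⟨ drop-zeros (W * (B * B)) (+ 6 * B) (+ 6 * (a * a) * B) ⟩
  W * (B * B) ∎))
  where
    open ≡-Reasoning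
    N : ℤ
    N = + m + q * B - + k * a
    W : ℤ
    W = + 3 * a - + 6 * q * q + + 6 * q * δ₀ m - + 3 * a * δ₀ m
        - + 6 * a * q * δ₀ k - + 3 * a * δ₀ k + + 3 * a * δ₀ m * δ₀ k
    expand : ∀ a B m k q dm dk → let N = m + q * B - k * a in
      + 3 * a * ((+ 2 * m - B + B * dm) * (+ 2 * k - B + B * dk))
        - ((+ 6 * (m * m) - + 12 * N * m - + 6 * a * B * m - + 6 * B * N * dm)
           + (+ 6 * ((k * a + N) * (k * a + N)) - + 6 * a * B * k + + 6 * a * B * N * dk))
      ≡ (+ 3 * a - + 6 * q * q + + 6 * q * dm - + 3 * a * dm
         - + 6 * a * q * dk - + 3 * a * dk + + 3 * a * dm * dk) * (B * B)
        + + 6 * B * (m * dm) + + 6 * (a * a) * B * (k * dk)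
    expand = solve-∀
    drop-zeros : ∀ x y z → x + y * + 0 + z * + 0 ≡ x
    drop-zeros = solve-∀

quadraticTerm : (a B N : ℤ) → ℕ → ℤ
quadraticTerm a B N k =
  (+ 1 + a * a) * (+ k * + k) + (+ 2 * (a - + 1) * N - + 2 * a * B) * + k + N * N

residue+index≡ : ∀ a B N k → residueTerm a B N k + indexTerm a B N k
                             ≡ + 6 * quadraticTerm a B N k + + 6 * (a - + 1) * B * N * δ₀ k
residue+index≡ a B N k = regroup a B N (+ k) (δ₀ k)
  where
    regroup : ∀ a B N k d →
      (+ 6 * (k * k) - + 12 * N * k - + 6 * a * B * k - + 6 * B * N * d)
        + (+ 6 * ((k * a + N) * (k * a + N)) - + 6 * a * B * k + + 6 * a * B * N * d)
      ≡ + 6 * ((+ 1 + a * a) * (k * k) + (+ 2 * (a - + 1) * N - + 2 * a * B) * k + N * N)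
        + + 6 * (a - + 1) * B * N * d
    regroup = solve-∀

sum-residue+index : ∀ a N b-1 → let b = ℕ.suc b-1 ; B = + b in
  sumℤ b (λ k → residueTerm a B N k + indexTerm a B N k)
    ≈ B * (+ 1 + a * a + + 6 * (N * N)) mod B * B
sum-residue+index a N b-1 = ≈mod-trans (≡⇒≈mod sum≡) (congruent (divides V (reduce a B N)))
  where
    b : ℕ
    b = ℕ.suc b-1
    B : ℤ
    B = + b
    sum≡ : sumℤ b (λ k → residueTerm a B N k + indexTerm a B N k)
           ≡ (+ 1 + a * a) * ((B - + 1) * B * (+ 2 * B - + 1))
             + + 3 * (+ 2 * (a - + 1) * N - + 2 * a * B) * (B * (B - + 1)) + + 6 * (N * N) * B
             + + 6 * (a - + 1) * B * N * + 1
    sum≡ = begin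
      sumℤ b (λ k → residueTerm a B N k + indexTerm a B N k)
        ≡⟨ sum-cong b (residue+index≡ a B N) ⟩
      sumℤ b (λ k → + 6 * quadraticTerm a B N k + + 6 * (a - + 1) * B * N * δ₀ k)
        ≡⟨ sum-+ b _ _ ⟩
      sumℤ b (λ k → + 6 * quadraticTerm a B N k) + sumℤ b (λ k → + 6 * (a - + 1) * B * N * δ₀ k)
        ≡⟨ cong₂ _+_ (sum-*ˡ b (+ 6) (quadraticTerm a B N))
                     (sum-*ˡ b (+ 6 * (a - + 1) * B * N) δ₀) ⟩
      + 6 * sumℤ b (quadraticTerm a B N) + + 6 * (a - + 1) * B * N * sumℤ b δ₀
        ≡⟨ cong₂ (λ s t → s + + 6 * (a - + 1) * B * N * t)
                 (sum-quadratic (+ 1 + a * a) (+ 2 * (a - + 1) * N - + 2 * a * B) (N * N) b)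
                 (sum-δ₀ b-1) ⟩
      _ ∎
      where open ≡-Reasoning
    V : ℤ
    V = (+ 1 + a * a) * (+ 2 * B - + 3) + + 6 * (a - + 1) * N - + 6 * a * (B - + 1)
    reduce : ∀ a B N →
      (+ 1 + a * a) * ((B - + 1) * B * (+ 2 * B - + 1))
        + + 3 * (+ 2 * (a - + 1) * N - + 2 * a * B) * (B * (B - + 1)) + + 6 * (N * N) * B
        + + 6 * (a - + 1) * B * N * + 1
        - B * (+ 1 + a * a + + 6 * (N * N))
      ≡ ((+ 1 + a * a) * (+ 2 * B - + 3) + + 6 * (a - + 1) * N - + 6 * a * (B - + 1)) * (B * B)
    reduce = solve-∀

rNumerator-congruence : ∀ n a b-1 → Coprime a (+ ℕ.suc b-1) → let B = + ℕ.suc b-1 in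
  + 3 * a * rNumerator n a (ℕ.suc b-1) ≈ B * (+ 1 + a * a + + 6 * (+ n * + n)) mod B * B
rNumerator-congruence n a b-1 a⊥b =
  ≈mod-trans (≡⇒≈mod (sym (sum-*ˡ b (+ 3 * a) summand)))
  (≈mod-trans (sum-≈mod b (λ k _ → term-congruence a B N k (m k) (q k) (N≡ k)))
  (≈mod-trans (≡⇒≈mod reindex)
              (sum-residue+index a N b-1)))
  where
    b : ℕ
    b = ℕ.suc b-1
    B N : ℤ
    B = + b
    N = + n
    summand : ℕ → ℤ
    summand k = scaledSaw B ((+ k * a + N) % B) * scaledSaw B k
    m : ℕ → ℕ
    m = affineResidue a⊥b N
    q : ℕ → ℤ
    q k = (+ k * a + N) / B
    N≡ : ∀ k → N ≡ + m k + q k * B - + k * a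
    N≡ k = trans (isolate (+ k * a) N) (cong (_- + k * a) (a≡a%n+[a/n]*n (+ k * a + N) B))
      where
        isolate : ∀ x y → y ≡ (x + y) - x
        isolate = solve-∀
    -- the residue terms run over a permutation of [0, b)
    reindex : sumℤ b (λ k → residueTerm a B N (m k) + indexTerm a B N k)
            ≡ sumℤ b (λ k → residueTerm a B N k + indexTerm a B N k)
    reindex = begin
      sumℤ b (λ k → residueTerm a B N (m k) + indexTerm a B N k)
        ≡⟨ sum-+ b (residueTerm a B N ∘ m) (indexTerm a B N) ⟩
      sumℤ b (residueTerm a B N ∘ m) + sumℤ b (indexTerm a B N)
        ≡⟨ cong (_+ sumℤ b (indexTerm a B N)) (sum-over-residues a⊥b N (residueTerm a B N)) ⟩
      sumℤ b (residueTerm a B N) + sumℤ b (indexTerm a B N)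
        ≡⟨ sum-+ b (residueTerm a B N) (indexTerm a B N) ⟨
      sumℤ b (λ k → residueTerm a B N k + indexTerm a B N k) ∎
      where open ≡-Reasoning

-- Eliminating a common T: if 3aᵢ·T ≡ B·cᵢ (mod B²) for i = 1, 2, then c₁a₂ ≡ c₂a₁ (mod B),
-- since B·c₁·a₂ ≡ 3a₁a₂T ≡ B·c₂·a₁ (mod B²).
eliminate-common : ∀ {T a₁ a₂ c₁ c₂} B .{{_ : Data.Integer.NonZero B}} →
                   + 3 * a₁ * T ≈ B * c₁ mod B * B → + 3 * a₂ * T ≈ B * c₂ mod B * B →
                   c₁ * a₂ ≈ c₂ * a₁ mod B
eliminate-common {T} {a₁} {a₂} {c₁} {c₂} B h₁ h₂ = ≈mod-cancel B
  (≈mod-trans (≡⇒≈mod (sym (*-assoc B c₁ a₂)))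
  (≈mod-trans (≈mod-*ʳ a₂ (≈mod-sym h₁))
  (≈mod-trans (≡⇒≈mod (swap a₁ a₂ T))
  (≈mod-trans (≈mod-*ʳ a₁ h₂)
              (≡⇒≈mod (*-assoc B c₂ a₁))))))
  where
    swap : ∀ a₁ a₂ T → + 3 * a₁ * T * a₂ ≡ + 3 * a₂ * T * a₁
    swap = solve-∀

theorem2 : (n : ℕ) (b : ℕ) .{{_ : NonZero b}} (a₁ a₂ : ℤ) →
    Coprime a₁ (+ b) → Coprime a₂ (+ b) →
    r n a₁ b ≡ r n a₂ b →
    (+ b) ∣ ((+ 6 * (+ n * + n) + + 1 - a₁ * a₂) * (a₂ - a₁))
theorem2 n ℕ.zero      a₁ a₂ _    _    _   = contradiction refl (ℕ.≢-nonZero⁻¹ 0)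
theorem2 n (ℕ.suc b-1) a₁ a₂ a₁⊥b a₂⊥b r≡r =
  Signed.∣⇒∣ᵤ (subst (+ b Signed.∣_) (factor a₁ a₂ (+ n))
                     (divides-difference (eliminate-common (+ b) congruence₁ congruence₂)))
  where
    b : ℕ
    b = ℕ.suc b-1
    T : ℤ
    T = rNumerator n a₁ b
    c : ℤ → ℤ
    c a = + 1 + a * a + + 6 * (+ n * + n)
    congruence₁ : + 3 * a₁ * T ≈ + b * c a₁ mod + b * + b
    congruence₁ = rNumerator-congruence n a₁ b-1 a₁⊥b
    congruence₂ : + 3 * a₂ * T ≈ + b * c a₂ mod + b * + b
    congruence₂ = subst (λ t → + 3 * a₂ * t ≈ + b * c a₂ mod + b * + b)
                        (sym (rNumerator-injective n a₁ a₂ b-1 r≡r))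
                        (rNumerator-congruence n a₂ b-1 a₂⊥b)
    factor : ∀ a₁ a₂ N →
      (+ 1 + a₁ * a₁ + + 6 * (N * N)) * a₂ - (+ 1 + a₂ * a₂ + + 6 * (N * N)) * a₁
        ≡ (+ 6 * (N * N) + + 1 - a₁ * a₂) * (a₂ - a₁)
    factor = solve-∀
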